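{- For any odd prime $p$ and any non-negative integer $k$, \[ B^{(-k)}_{p-1}\equiv \begin{cases} 1 \pmod{p} & \text{if } k=0 \text{ or } k\not\equiv 0 \pmod{p-1},\\ 2\pmod{p} & \text{if } k\neq 0 \text{ and } k\equiv 0\pmod{p-1}.\end{cases} \]
   Context: For any integer $k$, let $\mathrm{Li}_k(t)=\sum_{n\geq 1} t^n/n^k$ (for $k\le 0$ this is a rational function of $t$). The poly-Bernoulli numbers $B^{(k)}_n$ ($n\geq 0$) are defined by \[ \frac{\mathrm{Li}_{k}(1-e^{ -t})}{1-e^{ -t}}=\sum_{n=0}^{\infty}B^{(k)}_{n}\frac{t^n}{n!}. \] For non-positive upper index these are integers. -}

module Defs where

open import Data.Nat using (ℕ; zero; suc; _∸_)
open import Data.Nat.Combinatorics using (_C_)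
open import Data.Integer using (ℤ; +_; -_; _+_; _*_; _^_)

sumTo : ℕ → (ℕ → ℤ) → ℤ
sumTo zero    f = f 0
sumTo (suc m) f = sumTo m f + f (suc m)

-- A formal power series  F(t) = Σ_m a_m t^m / m!  is represented by its
-- sequence of exponential coefficients  a : ℕ → ℤ  (a_m = m! [t^m] F).
EGF : Set
EGF = ℕ → ℤ

-- product of formal power series in this representation (binomial convolution)
_⊛_ : EGF → EGF → EGF
(f ⊛ g) m = sumTo m (λ i → (+ (m C i)) * f i * g (m ∸ i))

oneE : EGF
oneE zero    = + 1
oneE (suc _) = + 0

powE : EGF → ℕ → EGF
powE f zero    = oneE
powE f (suc n) = f ⊛ powE f n

-- the power series  1 - e^{-t} = Σ_{m ≥ 1} (-1)^{m+1} t^m / m!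
oneMinusExpNeg : EGF
oneMinusExpNeg zero    = + 0
oneMinusExpNeg (suc m) = (- (+ 1)) ^ m

-- Li_{-k}(x)/x = Σ_{n ≥ 1} n^k x^{n-1}.  Substituting x = 1 - e^{-t}
-- (which has zero constant term), only the terms with n - 1 ≤ m contribute
-- to the coefficient of t^m, so
--   B^{(-k)}_m = m! [t^m] Σ_{n=1}^{m+1} n^k (1 - e^{-t})^{n-1}.
polyBernoulliNeg : ℕ → ℕ → ℤ
polyBernoulliNeg k m =
  sumTo m (λ j → (+ (suc j)) ^ k * powE oneMinusExpNeg j m)

{-# OPTIONS --safe #-}

-- Expanding (1 - e^{-t})^j = Σ_i (-1)^i C(j,i) e^{-it} gives
-- B^{(-k)}_m = Σ_{j ≤ m} (j+1)^k Σ_{i ≤ j} (-1)^i C(j,i) (-i)^m.  For m = p - 1, Fermat's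
-- little theorem turns (-i)^m into 1 - [i = 0] modulo p, so the inner sum collapses to
-- [j = 0] - 1 and B^{(-k)}_{p-1} ≡ 1 - Σ_{a=1}^{p} a^k.  For k ≥ 1 the term p^k drops out and
-- the power sum Σ_{a<p} a^k is periodic in k with period p - 1 (Fermat again).  At k = p - 1
-- it is ≡ p - 1 ≡ -1, while for 0 < k < p - 1 it vanishes, by induction on k using
-- Σ_{j ≤ k} C(k+1, j) Σ_{a<p} a^j = p^{k+1}.

module Submission where

open import Defs
open import Data.Nat using (ℕ; _∸_)
open import Data.Nat.Primality using (Prime)
open import Data.Integer using (ℤ; +_; _-_)
open import Data.Sum using (_⊎_)
open import Data.Product using (_×_)
open import Relation.Binary.PropositionalEquality using (_≡_; _≢_)
open import Relation.Nullary using (¬_)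
import Data.Nat.Divisibility as ℕD
import Data.Integer.Divisibility as ℤD

open import Data.Nat as ℕ using (zero; suc; z≤n; s≤s)
import Data.Nat.Properties as ℕP
open import Data.Nat.Combinatorics
  using (_C_; nCk+nC[k+1]≡[n+1]C[k+1]; nCn≡1; nC1≡n; nCk≡nC[n∸k])
open import Data.Nat.Combinatorics.Specification using (k>n⇒nCk≡0)
open import Data.Nat.Primality using (euclidsLemma; ¬prime[0]; ¬prime[1]; prime⇒nonZero)
open import Data.Nat.Divisibility using (>⇒∤; _∣0; m%n≡0⇒n∣m)
open import Data.Nat.DivMod using (_%_; _/_; m≡m%n+[m/n]*n; m%n<n)
open import Data.Nat.Induction using (<-rec)
import Data.Nat.Tactic.RingSolver as ℕSolver
open import Data.Fin using (toℕ; inject₁; fromℕ)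
open import Data.Fin.Properties using (toℕ-inject₁; toℕ-fromℕ)
open import Data.Integer using (-_; _+_; _*_; _^_; ∣_∣)
import Data.Integer.Properties as ℤP
open import Data.Integer.DivMod using (_%ℕ_; _/ℕ_; a≡a%ℕn+[a/ℕn]*n)
open import Data.Integer.Divisibility.Signed as ℤ∣
  using (divides; ∣m∣n⇒∣m+n; ∣m⇒∣-m; ∣n⇒∣m*n; ∣m⇒∣m*n; ∣ᵤ⇒∣; ∣⇒∣ᵤ)
open import Data.Integer.Tactic.RingSolver using (solve-∀)
open import Data.Sum using (inj₁; inj₂)
open import Data.Product using (_,_)
open import Relation.Nullary using (contradiction)
open import Relation.Binary.PropositionalEquality
  using (refl; sym; trans; cong; cong₂; subst; module ≡-Reasoning)
open import Relation.Binary.Bundles using (Setoid)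
open import Relation.Binary.Structures using (IsEquivalence)
import Relation.Binary.Reasoning.Setoid as SetoidReasoning
import Algebra.Properties.Monoid.Sum as MonoidSum
import Algebra.Properties.Monoid.Mult as MonoidMult
import Algebra.Properties.Semiring.Exp as SemiringExp
import Algebra.Properties.CommutativeSemiring.Binomial as Binomial

sumTo-cong : ∀ n {f g : ℕ → ℤ} → (∀ i → i ℕ.≤ n → f i ≡ g i) → sumTo n f ≡ sumTo n g
sumTo-cong zero    f≗g = f≗g 0 z≤n
sumTo-cong (suc n) f≗g =
  cong₂ _+_ (sumTo-cong n (λ i i≤n → f≗g i (ℕP.m≤n⇒m≤1+n i≤n))) (f≗g (suc n) ℕP.≤-refl)

sumTo-distrib-+ : ∀ n (f g : ℕ → ℤ) →
  sumTo n (λ i → f i + g i) ≡ sumTo n f + sumTo n g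
sumTo-distrib-+ zero    f g = refl
sumTo-distrib-+ (suc n) f g = begin
  sumTo n (λ i → f i + g i) + (f (suc n) + g (suc n))
    ≡⟨ cong (_+ (f (suc n) + g (suc n))) (sumTo-distrib-+ n f g) ⟩
  (sumTo n f + sumTo n g) + (f (suc n) + g (suc n))
    ≡⟨ interchange (sumTo n f) (sumTo n g) (f (suc n)) (g (suc n)) ⟩
  (sumTo n f + f (suc n)) + (sumTo n g + g (suc n)) ∎
  where
  open ≡-Reasoning
  interchange : ∀ a b c d → (a + b) + (c + d) ≡ (a + c) + (b + d)
  interchange = solve-∀

*-distribˡ-sumTo : ∀ n c (f : ℕ → ℤ) → sumTo n (λ i → c * f i) ≡ c * sumTo n f
*-distribˡ-sumTo zero    c f = refl
*-distribˡ-sumTo (suc n) c f =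
  trans (cong (_+ c * f (suc n)) (*-distribˡ-sumTo n c f))
        (sym (ℤP.*-distribˡ-+ c (sumTo n f) (f (suc n))))

neg-distrib-sumTo : ∀ n (f : ℕ → ℤ) → sumTo n (λ i → - f i) ≡ - sumTo n f
neg-distrib-sumTo zero    f = refl
neg-distrib-sumTo (suc n) f =
  trans (cong (_+ - f (suc n)) (neg-distrib-sumTo n f))
        (sym (ℤP.neg-distrib-+ (sumTo n f) (f (suc n))))

sumTo-distrib-minus : ∀ n (f g : ℕ → ℤ) →
  sumTo n (λ i → f i - g i) ≡ sumTo n f - sumTo n g
sumTo-distrib-minus n f g =
  trans (sumTo-distrib-+ n f (λ i → - g i)) (cong (_+_ (sumTo n f)) (neg-distrib-sumTo n g))

sumTo-suc : ∀ n (f : ℕ → ℤ) → sumTo (suc n) f ≡ f 0 + sumTo n (λ i → f (suc i))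
sumTo-suc zero    f = refl
sumTo-suc (suc n) f =
  trans (cong (_+ f (suc (suc n))) (sumTo-suc n f))
        (ℤP.+-assoc (f 0) (sumTo n (λ i → f (suc i))) (f (suc (suc n))))

sumTo-comm : ∀ m n (F : ℕ → ℕ → ℤ) →
  sumTo m (λ i → sumTo n (F i)) ≡ sumTo n (λ j → sumTo m (λ i → F i j))
sumTo-comm zero    n F = refl
sumTo-comm (suc m) n F =
  trans (cong (_+ sumTo n (F (suc m))) (sumTo-comm m n F))
        (sym (sumTo-distrib-+ n (λ j → sumTo m (λ i → F i j)) (F (suc m))))

sumTo-const : ∀ n c → sumTo n (λ _ → c) ≡ + suc n * c
sumTo-const zero    c = sym (ℤP.*-identityˡ c)
sumTo-const (suc n) c = begin
  sumTo n (λ _ → c) + c  ≡⟨ cong (_+ c) (sumTo-const n c) ⟩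
  + suc n * c + c        ≡⟨ cong (_+_ (+ suc n * c)) (sym (ℤP.*-identityˡ c)) ⟩
  + suc n * c + + 1 * c  ≡⟨ sym (ℤP.*-distribʳ-+ c (+ suc n) (+ 1)) ⟩
  + (suc n ℕ.+ 1) * c    ≡⟨ cong (λ k → + k * c) (ℕP.+-comm (suc n) 1) ⟩
  + suc (suc n) * c      ∎
  where open ≡-Reasoning

sumTo-*-0^ : ∀ n (f : ℕ → ℤ) → sumTo n (λ i → f i * (+ 0) ^ i) ≡ f 0
sumTo-*-0^ zero    f = ℤP.*-identityʳ (f 0)
sumTo-*-0^ (suc n) f =
  trans (cong₂ _+_ (sumTo-*-0^ n f) (ℤP.*-zeroʳ (f (suc n)))) (ℤP.+-identityʳ (f 0))

sumTo-telescope : ∀ n (f : ℕ → ℤ) → sumTo n (λ i → f (suc i) - f i) ≡ f (suc n) - f 0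
sumTo-telescope zero    f = refl
sumTo-telescope (suc n) f = begin
  sumTo n (λ i → f (suc i) - f i) + (f (suc (suc n)) - f (suc n))
    ≡⟨ cong (_+ (f (suc (suc n)) - f (suc n))) (sumTo-telescope n f) ⟩
  (f (suc n) - f 0) + (f (suc (suc n)) - f (suc n))
    ≡⟨ cancel (f 0) (f (suc n)) (f (suc (suc n))) ⟩
  f (suc (suc n)) - f 0 ∎
  where
  open ≡-Reasoning
  cancel : ∀ a b c → (b - a) + (c - b) ≡ c - a
  cancel = solve-∀

sumTo-pascal : ∀ n (h : ℕ → ℤ) →
  sumTo (suc n) (λ i → + (suc n C i) * h i)
    ≡ sumTo n (λ i → + (n C i) * h i) + sumTo n (λ i → + (n C i) * h (suc i))
sumTo-pascal n h = begin
  sumTo (suc n) (λ i → + (suc n C i) * h i)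
    ≡⟨ sumTo-suc n _ ⟩
  + 1 * h 0 + sumTo n (λ i → + (suc n C suc i) * h (suc i))
    ≡⟨ cong (_+_ (+ 1 * h 0)) (trans (sumTo-cong n (λ i _ → pascal i)) (sumTo-distrib-+ n _ _)) ⟩
  + 1 * h 0 + (A + B)
    ≡⟨ regroup (+ 1 * h 0) A B ⟩
  (+ 1 * h 0 + B) + A
    ≡⟨ cong (_+ A) (sym (sumTo-suc n G)) ⟩
  (sumTo n G + G (suc n)) + A
    ≡⟨ cong (λ c → sumTo n G + + c * h (suc n) + A) (k>n⇒nCk≡0 (ℕP.n<1+n n)) ⟩
  (sumTo n G + + 0) + A
    ≡⟨ cong (_+ A) (ℤP.+-identityʳ (sumTo n G)) ⟩
  sumTo n G + A ∎
  where
  open ≡-Reasoning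
  G : ℕ → ℤ
  G i = + (n C i) * h i
  A B : ℤ
  A = sumTo n (λ i → + (n C i) * h (suc i))
  B = sumTo n (λ i → G (suc i))
  pascal : ∀ i → + (suc n C suc i) * h (suc i) ≡ + (n C i) * h (suc i) + G (suc i)
  pascal i = begin
    + (suc n C suc i) * h (suc i)
      ≡⟨ cong (λ c → + c * h (suc i)) (sym (nCk+nC[k+1]≡[n+1]C[k+1] n i)) ⟩
    + (n C i ℕ.+ n C suc i) * h (suc i)
      ≡⟨ ℤP.*-distribʳ-+ (h (suc i)) (+ (n C i)) (+ (n C suc i)) ⟩
    + (n C i) * h (suc i) + G (suc i) ∎
  regroup : ∀ a b c → a + (b + c) ≡ (a + c) + b
  regroup = solve-∀

open MonoidSum ℤP.+-0-monoid using (sum⁺-syntax; sum-init-last; sum-cong-≗)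
module ℤMult = MonoidMult ℤP.+-0-monoid
module ℤExp = SemiringExp ℤP.+-*-semiring

sumTo≡∑ : ∀ n (f : ℕ → ℤ) → sumTo n f ≡ ∑[ i ≤ n ] f (toℕ i)
sumTo≡∑ zero    f = sym (ℤP.+-identityʳ (f 0))
sumTo≡∑ (suc n) f = begin
  sumTo n f + f (suc n)
    ≡⟨ cong₂ _+_ (trans (sumTo≡∑ n f) (sum-cong-≗ {suc n} (λ i → cong f (sym (toℕ-inject₁ i)))))
                 (cong f (sym (toℕ-fromℕ (suc n)))) ⟩
  ∑[ i ≤ n ] f (toℕ (inject₁ i)) + f (toℕ (fromℕ (suc n)))
    ≡⟨ sym (sum-init-last {suc n} (λ i → f (toℕ i))) ⟩
  ∑[ i ≤ suc n ] f (toℕ i) ∎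
  where open ≡-Reasoning

monoid-×≡* : ∀ n x → n ℤMult.× x ≡ + n * x
monoid-×≡* zero    x = refl
monoid-×≡* (suc n) x = trans (cong (_+_ x) (monoid-×≡* n x)) (sym (ℤP.suc-* (+ n) x))

semiring-^≡^ : ∀ x n → x ℤExp.^ n ≡ x ^ n
semiring-^≡^ x zero    = refl
semiring-^≡^ x (suc n) = cong (_*_ x) (semiring-^≡^ x n)

-- Stated so that the left-hand side is literally (expE x ⊛ expE y) n.
binomial : ∀ n x y → sumTo n (λ i → + (n C i) * x ^ i * y ^ (n ∸ i)) ≡ (x + y) ^ n
binomial n x y = begin
  sumTo n (λ i → + (n C i) * x ^ i * y ^ (n ∸ i))
    ≡⟨ sumTo≡∑ n _ ⟩
  ∑[ i ≤ n ] (+ (n C toℕ i) * x ^ toℕ i * y ^ (n ∸ toℕ i))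
    ≡⟨ sum-cong-≗ term ⟩
  Binomial.binomialExpansion ℤP.+-*-commutativeSemiring x y n
    ≡⟨ sym (Binomial.theorem ℤP.+-*-commutativeSemiring n x y) ⟩
  (x + y) ℤExp.^ n
    ≡⟨ semiring-^≡^ (x + y) n ⟩
  (x + y) ^ n ∎
  where
  open ≡-Reasoning
  term : ∀ i → + (n C toℕ i) * x ^ toℕ i * y ^ (n ∸ toℕ i)
             ≡ Binomial.binomialTerm ℤP.+-*-commutativeSemiring x y n i
  term i = begin
    + (n C toℕ i) * x ^ toℕ i * y ^ (n ∸ toℕ i)
      ≡⟨ ℤP.*-assoc (+ (n C toℕ i)) _ _ ⟩
    + (n C toℕ i) * (x ^ toℕ i * y ^ (n ∸ toℕ i))
      ≡⟨ sym (monoid-×≡* (n C toℕ i) _) ⟩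
    (n C toℕ i) ℤMult.× (x ^ toℕ i * y ^ (n ∸ toℕ i))
      ≡⟨ cong₂ (λ a b → (n C toℕ i) ℤMult.× (a * b))
               (sym (semiring-^≡^ x (toℕ i))) (sym (semiring-^≡^ y (n ∸ toℕ i))) ⟩
    Binomial.binomialTerm ℤP.+-*-commutativeSemiring x y n i ∎

[k+1]*[n+1]C[k+1]≡[n+1]*nCk : ∀ n k → suc k ℕ.* (suc n C suc k) ≡ suc n ℕ.* (n C k)
[k+1]*[n+1]C[k+1]≡[n+1]*nCk zero    zero    = refl
[k+1]*[n+1]C[k+1]≡[n+1]*nCk zero    (suc k) = ℕP.*-zeroʳ (suc (suc k))
[k+1]*[n+1]C[k+1]≡[n+1]*nCk (suc n) zero    =
  trans (ℕP.*-identityˡ _) (trans (nC1≡n (suc (suc n))) (sym (ℕP.*-identityʳ _)))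
[k+1]*[n+1]C[k+1]≡[n+1]*nCk (suc n) (suc k) = begin
  (2 ℕ.+ k) ℕ.* (suc (suc n) C suc (suc k))
    ≡⟨ cong ((2 ℕ.+ k) ℕ.*_) (sym (nCk+nC[k+1]≡[n+1]C[k+1] (suc n) (suc k))) ⟩
  (2 ℕ.+ k) ℕ.* (a ℕ.+ b)
    ≡⟨ split k a b ⟩
  (1 ℕ.+ k) ℕ.* a ℕ.+ a ℕ.+ (2 ℕ.+ k) ℕ.* b
    ≡⟨ cong₂ (λ u v → u ℕ.+ a ℕ.+ v)
             ([k+1]*[n+1]C[k+1]≡[n+1]*nCk n k) ([k+1]*[n+1]C[k+1]≡[n+1]*nCk n (suc k)) ⟩
  (1 ℕ.+ n) ℕ.* (n C k) ℕ.+ a ℕ.+ (1 ℕ.+ n) ℕ.* (n C suc k)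
    ≡⟨ merge n (n C k) a (n C suc k) ⟩
  (1 ℕ.+ n) ℕ.* (n C k ℕ.+ n C suc k) ℕ.+ a
    ≡⟨ cong (λ u → (1 ℕ.+ n) ℕ.* u ℕ.+ a) (nCk+nC[k+1]≡[n+1]C[k+1] n k) ⟩
  (1 ℕ.+ n) ℕ.* a ℕ.+ a
    ≡⟨ ℕP.+-comm ((1 ℕ.+ n) ℕ.* a) a ⟩
  (2 ℕ.+ n) ℕ.* a ∎
  where
  open ≡-Reasoning
  a b : ℕ
  a = suc n C suc k
  b = suc n C suc (suc k)
  split : ∀ k a b → (2 ℕ.+ k) ℕ.* (a ℕ.+ b) ≡ (1 ℕ.+ k) ℕ.* a ℕ.+ a ℕ.+ (2 ℕ.+ k) ℕ.* b
  split = ℕSolver.solve-∀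
  merge : ∀ n c a d →
    (1 ℕ.+ n) ℕ.* c ℕ.+ a ℕ.+ (1 ℕ.+ n) ℕ.* d ≡ (1 ℕ.+ n) ℕ.* (c ℕ.+ d) ℕ.+ a
  merge = ℕSolver.solve-∀

[n+1]Cn≡n+1 : ∀ n → suc n C n ≡ suc n
[n+1]Cn≡n+1 n = begin
  suc n C n              ≡⟨ nCk≡nC[n∸k] (ℕP.n≤1+n n) ⟩
  suc n C (suc n ∸ n)    ≡⟨ cong (suc n C_) (ℕP.m+n∸n≡m 1 n) ⟩
  suc n C 1              ≡⟨ nC1≡n (suc n) ⟩
  suc n                  ∎
  where open ≡-Reasoning

-- Exponential generating functions

expE : ℤ → EGF
expE c m = c ^ m

⊛-congʳ : ∀ f {g h : EGF} → (∀ n → g n ≡ h n) → ∀ m → (f ⊛ g) m ≡ (f ⊛ h) m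
⊛-congʳ f g≗h m = sumTo-cong m (λ i _ → cong (_*_ (+ (m C i) * f i)) (g≗h (m ∸ i)))

oneMinusExpNeg-⊛ : ∀ g m → (oneMinusExpNeg ⊛ g) m ≡ g m - (expE (- + 1) ⊛ g) m
oneMinusExpNeg-⊛ g m = begin
  sumTo m (λ i → + (m C i) * oneMinusExpNeg i * g (m ∸ i))
    ≡⟨ sumTo-cong m (λ i _ → split i) ⟩
  sumTo m (λ i → c i * (+ 0) ^ i - + (m C i) * (- + 1) ^ i * g (m ∸ i))
    ≡⟨ sumTo-distrib-minus m _ _ ⟩
  sumTo m (λ i → c i * (+ 0) ^ i) - (expE (- + 1) ⊛ g) m
    ≡⟨ cong (_- (expE (- + 1) ⊛ g) m) (trans (sumTo-*-0^ m c) (ℤP.*-identityˡ (g m))) ⟩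
  g m - (expE (- + 1) ⊛ g) m ∎
  where
  open ≡-Reasoning
  c : ℕ → ℤ
  c i = + (m C i) * g (m ∸ i)
  oneMinusExpNeg≡ : ∀ i → oneMinusExpNeg i ≡ (+ 0) ^ i - (- + 1) ^ i
  oneMinusExpNeg≡ zero    = refl
  oneMinusExpNeg≡ (suc i) = sym (negate ((- + 1) ^ i))
    where
    negate : ∀ e → + 0 - (- + 1) * e ≡ e
    negate = solve-∀
  split : ∀ i → + (m C i) * oneMinusExpNeg i * g (m ∸ i)
              ≡ c i * (+ 0) ^ i - + (m C i) * (- + 1) ^ i * g (m ∸ i)
  split i = trans (cong (λ e → + (m C i) * e * g (m ∸ i)) (oneMinusExpNeg≡ i))
                  (expand (+ (m C i)) ((+ 0) ^ i) ((- + 1) ^ i) (g (m ∸ i)))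
    where
    expand : ∀ c z e y → c * (z - e) * y ≡ c * y * z - c * e * y
    expand = solve-∀

⊛-distrib-sumTo : ∀ f j (a : ℕ → ℤ) (G : ℕ → EGF) m →
  (f ⊛ (λ n → sumTo j (λ l → a l * G l n))) m ≡ sumTo j (λ l → a l * (f ⊛ G l) m)
⊛-distrib-sumTo f j a G m = begin
  sumTo m (λ i → c i * sumTo j (λ l → a l * G l (m ∸ i)))
    ≡⟨ sumTo-cong m (λ i _ → trans (sym (*-distribˡ-sumTo j (c i) _))
                                   (sumTo-cong j (λ l _ → swap (c i) (a l) _))) ⟩
  sumTo m (λ i → sumTo j (λ l → a l * (c i * G l (m ∸ i))))
    ≡⟨ sumTo-comm m j _ ⟩
  sumTo j (λ l → sumTo m (λ i → a l * (c i * G l (m ∸ i))))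
    ≡⟨ sumTo-cong j (λ l _ → *-distribˡ-sumTo m (a l) _) ⟩
  sumTo j (λ l → a l * (f ⊛ G l) m) ∎
  where
  open ≡-Reasoning
  c : ℕ → ℤ
  c i = + (m C i) * f i
  swap : ∀ x y z → x * (y * z) ≡ y * (x * z)
  swap = solve-∀

powE-oneMinusExpNeg : ∀ j m →
  powE oneMinusExpNeg j m ≡ sumTo j (λ i → + (j C i) * (- + 1) ^ i * (- + i) ^ m)
powE-oneMinusExpNeg zero    zero    = refl
powE-oneMinusExpNeg zero    (suc m) = refl
powE-oneMinusExpNeg (suc j) m = begin
  (oneMinusExpNeg ⊛ powE oneMinusExpNeg j) m
    ≡⟨ ⊛-congʳ oneMinusExpNeg (powE-oneMinusExpNeg j) m ⟩
  (oneMinusExpNeg ⊛ P) m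
    ≡⟨ oneMinusExpNeg-⊛ P m ⟩
  P m - (expE (- + 1) ⊛ P) m
    ≡⟨ cong (_-_ (P m)) (⊛-distrib-sumTo (expE (- + 1)) j a (λ i → expE (- + i)) m) ⟩
  P m - sumTo j (λ i → a i * (expE (- + 1) ⊛ expE (- + i)) m)
    ≡⟨ cong (_-_ (P m)) (sumTo-cong j (λ i _ → cong (_*_ (a i)) (binomial m (- + 1) (- + i)))) ⟩
  P m - sumTo j (λ i → a i * (- + 1 + - + i) ^ m)
    ≡⟨ cong₂ _+_ (sumTo-cong j (λ i _ → ℤP.*-assoc (+ (j C i)) _ _))
                 (trans (sym (neg-distrib-sumTo j _)) (sumTo-cong j (λ i _ → shift i))) ⟩
  sumTo j (λ i → + (j C i) * h i) + sumTo j (λ i → + (j C i) * h (suc i))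
    ≡⟨ sym (sumTo-pascal j h) ⟩
  sumTo (suc j) (λ i → + (suc j C i) * h i)
    ≡⟨ sumTo-cong (suc j) (λ i _ → sym (ℤP.*-assoc (+ (suc j C i)) _ _)) ⟩
  sumTo (suc j) (λ i → + (suc j C i) * (- + 1) ^ i * (- + i) ^ m) ∎
  where
  open ≡-Reasoning
  a : ℕ → ℤ
  a i = + (j C i) * (- + 1) ^ i
  P : EGF
  P n = sumTo j (λ i → a i * (- + i) ^ n)
  h : ℕ → ℤ
  h i = (- + 1) ^ i * (- + i) ^ m
  shift : ∀ i → - (a i * (- + 1 + - + i) ^ m) ≡ + (j C i) * h (suc i)
  shift i = trans (negate (+ (j C i)) ((- + 1) ^ i) ((- + 1 + - + i) ^ m))
                  (cong (λ e → + (j C i) * ((- + 1) ^ suc i * e ^ m))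
                        (sym (ℤP.neg-distrib-+ (+ 1) (+ i))))
    where
    negate : ∀ c s x → - (c * s * x) ≡ c * ((- + 1) * s * x)
    negate = solve-∀

-- Congruences modulo n

infix 4 _≡_mod_

record _≡_mod_ (x y : ℤ) (n : ℕ) : Set where
  constructor mod-∣
  field ∣-difference : + n ℤ∣.∣ x - y

open _≡_mod_

module _ {n : ℕ} where

  ≡⇒≡mod : ∀ {x y} → x ≡ y → x ≡ y mod n
  ≡⇒≡mod {x} refl = mod-∣ (subst (+ n ℤ∣.∣_) (sym (ℤP.+-inverseʳ x)) (divides (+ 0) refl))

  ≡mod-refl : ∀ {x} → x ≡ x mod n
  ≡mod-refl = ≡⇒≡mod refl

  ≡mod-sym : ∀ {x y} → x ≡ y mod n → y ≡ x mod n
  ≡mod-sym {x} {y} (mod-∣ d) = mod-∣ (subst (+ n ℤ∣.∣_) (negate x y) (∣m⇒∣-m d))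
    where
    negate : ∀ x y → - (x - y) ≡ y - x
    negate = solve-∀

  ≡mod-trans : ∀ {x y z} → x ≡ y mod n → y ≡ z mod n → x ≡ z mod n
  ≡mod-trans {x} {y} {z} (mod-∣ d) (mod-∣ e) =
    mod-∣ (subst (+ n ℤ∣.∣_) (chain x y z) (∣m∣n⇒∣m+n d e))
    where
    chain : ∀ x y z → (x - y) + (y - z) ≡ x - z
    chain = solve-∀

  ≡mod-isEquivalence : IsEquivalence (λ x y → x ≡ y mod n)
  ≡mod-isEquivalence = record { refl = ≡mod-refl ; sym = ≡mod-sym ; trans = ≡mod-trans }

  +-cong-mod : ∀ {a b c d} → a ≡ b mod n → c ≡ d mod n → a + c ≡ b + d mod n
  +-cong-mod {a} {b} {c} {d} (mod-∣ u) (mod-∣ v) =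
    mod-∣ (subst (+ n ℤ∣.∣_) (regroup a b c d) (∣m∣n⇒∣m+n u v))
    where
    regroup : ∀ a b c d → (a - b) + (c - d) ≡ (a + c) - (b + d)
    regroup = solve-∀

  neg-cong-mod : ∀ {a b} → a ≡ b mod n → - a ≡ - b mod n
  neg-cong-mod {a} {b} (mod-∣ u) = mod-∣ (subst (+ n ℤ∣.∣_) (negate a b) (∣m⇒∣-m u))
    where
    negate : ∀ a b → - (a - b) ≡ - a - - b
    negate = solve-∀

  minus-cong-mod : ∀ {a b c d} → a ≡ b mod n → c ≡ d mod n → a - c ≡ b - d mod n
  minus-cong-mod a≡b c≡d = +-cong-mod a≡b (neg-cong-mod c≡d)

  *-cong-mod : ∀ {a b c d} → a ≡ b mod n → c ≡ d mod n → a * c ≡ b * d mod n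
  *-cong-mod {a} {b} {c} {d} (mod-∣ u) (mod-∣ v) =
    mod-∣ (subst (+ n ℤ∣.∣_) (expand a b c d) (∣m∣n⇒∣m+n (∣n⇒∣m*n a v) (∣m⇒∣m*n d u)))
    where
    expand : ∀ a b c d → a * (c - d) + (a - b) * d ≡ a * c - b * d
    expand = solve-∀

  ^-cong-mod : ∀ {a b} → a ≡ b mod n → ∀ k → a ^ k ≡ b ^ k mod n
  ^-cong-mod a≡b zero    = ≡mod-refl
  ^-cong-mod a≡b (suc k) = *-cong-mod a≡b (^-cong-mod a≡b k)

  sumTo-cong-mod : ∀ m {f g : ℕ → ℤ} →
    (∀ i → i ℕ.≤ m → f i ≡ g i mod n) → sumTo m f ≡ sumTo m g mod n
  sumTo-cong-mod zero    f≡g = f≡g 0 z≤n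
  sumTo-cong-mod (suc m) f≡g =
    +-cong-mod (sumTo-cong-mod m (λ i i≤m → f≡g i (ℕP.m≤n⇒m≤1+n i≤m))) (f≡g (suc m) ℕP.≤-refl)

  sumTo-≡0-mod : ∀ m {f : ℕ → ℤ} →
    (∀ i → i ℕ.≤ m → f i ≡ + 0 mod n) → sumTo m f ≡ + 0 mod n
  sumTo-≡0-mod zero    f≡0 = f≡0 0 z≤n
  sumTo-≡0-mod (suc m) f≡0 =
    +-cong-mod (sumTo-≡0-mod m (λ i i≤m → f≡0 i (ℕP.m≤n⇒m≤1+n i≤m))) (f≡0 (suc m) ℕP.≤-refl)

  ∣⇒≡0-mod : ∀ {x} → + n ℤ∣.∣ x → x ≡ + 0 mod n
  ∣⇒≡0-mod {x} d = mod-∣ (subst (+ n ℤ∣.∣_) (sym (ℤP.+-identityʳ x)) d)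

  n≡0-mod : + n ≡ + 0 mod n
  n≡0-mod = ∣⇒≡0-mod ℤ∣.∣-refl

  n^suc≡0-mod : ∀ k → (+ n) ^ suc k ≡ + 0 mod n
  n^suc≡0-mod k = ∣⇒≡0-mod (∣m⇒∣m*n ((+ n) ^ k) ℤ∣.∣-refl)

≡mod-setoid : ℕ → Setoid _ _
≡mod-setoid n = record { isEquivalence = ≡mod-isEquivalence {n} }

module ≡mod-Reasoning (n : ℕ) = SetoidReasoning (≡mod-setoid n)

-- Fermat's little theorem

prime∣pCk : ∀ {p k} → Prime p → 0 ℕ.< k → k ℕ.< p → p ℕD.∣ p C k
prime∣pCk {suc n} {suc k} p-prime _ k<p
  with euclidsLemma (suc k) (suc n C suc k) p-prime
         (ℕD.divides (n C k) (trans ([k+1]*[n+1]C[k+1]≡[n+1]*nCk n k) (ℕP.*-comm (suc n) (n C k))))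
... | inj₁ p∣k+1 = contradiction p∣k+1 (>⇒∤ k<p)
... | inj₂ p∣pCk = p∣pCk

0<∣x∣<n⇒n∤x : ∀ {n a} x → ∣ x ∣ ≡ suc a → suc a ℕ.< n → ¬ (+ n ℤ∣.∣ x)
0<∣x∣<n⇒n∤x {n} x ∣x∣≡a a<n n∣x = >⇒∤ a<n (subst (n ℕD.∣_) ∣x∣≡a (∣⇒∣ᵤ n∣x))

euclidsLemmaℤ : ∀ {p} x y → Prime p → + p ℤ∣.∣ x * y → + p ℤ∣.∣ x ⊎ + p ℤ∣.∣ y
euclidsLemmaℤ {p} x y p-prime p∣xy
  with euclidsLemma ∣ x ∣ ∣ y ∣ p-prime (subst (p ℕD.∣_) (ℤP.abs-* x y) (∣⇒∣ᵤ p∣xy))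
... | inj₁ p∣x = inj₁ (∣ᵤ⇒∣ p∣x)
... | inj₂ p∣y = inj₂ (∣ᵤ⇒∣ p∣y)

*-cancelˡ-mod : ∀ {p x y z} → Prime p → ¬ (+ p ℤ∣.∣ x) → x * y ≡ x * z mod p → y ≡ z mod p
*-cancelˡ-mod {p} {x} {y} {z} p-prime p∤x (mod-∣ p∣xy-xz)
  with euclidsLemmaℤ x (y - z) p-prime (subst (+ p ℤ∣.∣_) (factor x y z) p∣xy-xz)
  where
  factor : ∀ x y z → x * y - x * z ≡ x * (y - z)
  factor = solve-∀
... | inj₁ p∣x   = contradiction p∣x p∤x
... | inj₂ p∣y-z = mod-∣ p∣y-z

freshman's-dream : ∀ {p} → Prime p → ∀ x y → (x + y) ^ p ≡ x ^ p + y ^ p mod p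
freshman's-dream {zero}        p-prime = contradiction p-prime ¬prime[0]
freshman's-dream {suc zero}    p-prime = contradiction p-prime ¬prime[1]
freshman's-dream {suc (suc n)} p-prime x y = begin
  (x + y) ^ p
    ≡⟨ sym (binomial p x y) ⟩
  sumTo (suc n) T + T p
    ≡⟨ cong (_+ T p) (sumTo-suc n T) ⟩
  (T 0 + sumTo n (λ i → T (suc i))) + T p
    ≈⟨ +-cong-mod (+-cong-mod (≡mod-refl {x = T 0}) middle≡0) (≡mod-refl {x = T p}) ⟩
  (T 0 + + 0) + T p
    ≡⟨ cong₂ (λ c e → (T 0 + + 0) + + c * x ^ p * y ^ e) (nCn≡1 p) (ℕP.n∸n≡0 p) ⟩
  (+ 1 * + 1 * y ^ p + + 0) + + 1 * x ^ p * + 1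
    ≡⟨ simplify (x ^ p) (y ^ p) ⟩
  x ^ p + y ^ p ∎
  where
  open ≡mod-Reasoning (suc (suc n))
  p : ℕ
  p = suc (suc n)
  T : ℕ → ℤ
  T i = + (p C i) * x ^ i * y ^ (p ∸ i)
  middle≡0 : sumTo n (λ i → T (suc i)) ≡ + 0 mod p
  middle≡0 = sumTo-≡0-mod n (λ i i≤n → ∣⇒≡0-mod
    (∣m⇒∣m*n (y ^ (p ∸ suc i)) (∣m⇒∣m*n {m = + (p C suc i)} (x ^ suc i)
      (∣ᵤ⇒∣ (prime∣pCk p-prime (s≤s z≤n) (s≤s (s≤s i≤n)))))))
  simplify : ∀ a b → (+ 1 * + 1 * b + + 0) + + 1 * a * + 1 ≡ a + b
  simplify = solve-∀

fermat-ℕ : ∀ {p} → Prime p → ∀ a → (+ a) ^ p ≡ + a mod p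
fermat-ℕ {zero}  p-prime _       = contradiction p-prime ¬prime[0]
fermat-ℕ {suc n} p-prime zero    = ≡mod-refl
fermat-ℕ {suc n} p-prime (suc a) = begin
  (+ suc a) ^ p          ≡⟨ cong (_^ p) (ℤP.pos-+ 1 a) ⟩
  (+ 1 + + a) ^ p        ≈⟨ freshman's-dream p-prime (+ 1) (+ a) ⟩
  (+ 1) ^ p + (+ a) ^ p  ≈⟨ +-cong-mod (≡⇒≡mod (ℤP.^-zeroˡ p)) (fermat-ℕ p-prime a) ⟩
  + 1 + + a              ≡⟨ sym (ℤP.pos-+ 1 a) ⟩
  + suc a                ∎
  where
  open ≡mod-Reasoning (suc n)
  p : ℕ
  p = suc n

fermat : ∀ {p} → Prime p → ∀ x → x ^ p ≡ x mod p
fermat {p} p-prime x = begin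
  x ^ p      ≈⟨ ^-cong-mod x≡r p ⟩
  (+ r) ^ p  ≈⟨ fermat-ℕ p-prime r ⟩
  + r        ≈⟨ ≡mod-sym x≡r ⟩
  x          ∎
  where
  open ≡mod-Reasoning p
  instance _ = prime⇒nonZero p-prime
  r : ℕ
  r = x %ℕ p
  x≡r : x ≡ + r mod p
  x≡r = mod-∣ (divides (x /ℕ p)
          (trans (cong (_- + r) (a≡a%ℕn+[a/ℕn]*n x p)) (cancel (+ r) ((x /ℕ p) * + p))))
    where
    cancel : ∀ r s → (r + s) - r ≡ s
    cancel = solve-∀

fermat-unit : ∀ {m x} → Prime (suc m) → ¬ (+ suc m ℤ∣.∣ x) → x ^ m ≡ + 1 mod suc m
fermat-unit {m} {x} p-prime p∤x = *-cancelˡ-mod {x = x} {y = x ^ m} {z = + 1} p-prime p∤x (begin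
  x ^ suc m  ≈⟨ fermat p-prime x ⟩
  x          ≡⟨ sym (ℤP.*-identityʳ x) ⟩
  x * + 1    ∎)
  where open ≡mod-Reasoning (suc m)

-- 1 - 0 ^ i is the indicator of i ≢ 0.
fermat-indicator : ∀ {m x i} → Prime (suc m) → ∣ x ∣ ≡ i → i ℕ.≤ m →
  x ^ m ≡ + 1 - (+ 0) ^ i mod suc m
fermat-indicator {zero}              p-prime _ _ = contradiction p-prime ¬prime[1]
fermat-indicator {suc m} {x} {zero}  p-prime ∣x∣≡0 _ =
  ≡⇒≡mod (cong (_^ suc m) (ℤP.∣i∣≡0⇒i≡0 {x} ∣x∣≡0))
fermat-indicator {suc m} {x} {suc i} p-prime ∣x∣≡i i≤m =
  fermat-unit {x = x} p-prime (0<∣x∣<n⇒n∤x x ∣x∣≡i (s≤s i≤m))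

^-periodic : ∀ {n m x} → x ^ suc m ≡ x mod n →
  ∀ r d → x ^ (suc r ℕ.+ d ℕ.* m) ≡ x ^ suc r mod n
^-periodic {n} {m} {x} xᵐ⁺¹≡x r zero    = ≡⇒≡mod (cong (x ^_) (ℕP.+-identityʳ (suc r)))
^-periodic {n} {m} {x} xᵐ⁺¹≡x r (suc d) = begin
  x ^ (suc r ℕ.+ (m ℕ.+ d ℕ.* m))
    ≡⟨ cong (x ^_) (regroup r m (d ℕ.* m)) ⟩
  x ^ (e ℕ.+ suc m)
    ≡⟨ ℤP.^-distribˡ-+-* x e (suc m) ⟩
  x ^ e * x ^ suc m
    ≈⟨ *-cong-mod (≡mod-refl {x = x ^ e}) xᵐ⁺¹≡x ⟩
  x ^ e * x
    ≡⟨ ℤP.*-comm (x ^ e) x ⟩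
  x ^ (suc r ℕ.+ d ℕ.* m)
    ≈⟨ ^-periodic xᵐ⁺¹≡x r d ⟩
  x ^ suc r ∎
  where
  open ≡mod-Reasoning n
  e : ℕ
  e = r ℕ.+ d ℕ.* m
  regroup : ∀ r m f → suc r ℕ.+ (m ℕ.+ f) ≡ (r ℕ.+ f) ℕ.+ suc m
  regroup = ℕSolver.solve-∀

-- Power sums

powerSum : ℕ → ℕ → ℤ
powerSum n r = sumTo n (λ a → (+ a) ^ r)

powerSum-recurrence : ∀ n k →
  sumTo k (λ j → + (suc k C j) * powerSum n j) ≡ (+ suc n) ^ suc k
powerSum-recurrence n k = begin
  sumTo k (λ j → + (suc k C j) * powerSum n j)
    ≡⟨ sumTo-cong k (λ j _ → sym (*-distribˡ-sumTo n (+ (suc k C j)) _)) ⟩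
  sumTo k (λ j → sumTo n (λ a → + (suc k C j) * (+ a) ^ j))
    ≡⟨ sumTo-comm k n _ ⟩
  sumTo n (λ a → sumTo k (λ j → + (suc k C j) * (+ a) ^ j))
    ≡⟨ sumTo-cong n (λ a _ → binomial-increment a) ⟩
  sumTo n (λ a → (+ suc a) ^ suc k - (+ a) ^ suc k)
    ≡⟨ sumTo-telescope n (λ a → (+ a) ^ suc k) ⟩
  (+ suc n) ^ suc k - + 0
    ≡⟨ ℤP.+-identityʳ _ ⟩
  (+ suc n) ^ suc k ∎
  where
  open ≡-Reasoning
  binomial-increment : ∀ a →
    sumTo k (λ j → + (suc k C j) * (+ a) ^ j) ≡ (+ suc a) ^ suc k - (+ a) ^ suc k
  binomial-increment a = begin
    sumTo k (λ j → + (suc k C j) * (+ a) ^ j)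
      ≡⟨ sumTo-cong k (λ j _ → sym (trans (cong (_*_ (+ (suc k C j) * (+ a) ^ j))
                                                (ℤP.^-zeroˡ (suc k ∸ j)))
                                          (ℤP.*-identityʳ (+ (suc k C j) * (+ a) ^ j)))) ⟩
    sumTo k T
      ≡⟨ add-sub (sumTo k T) (T (suc k)) ⟩
    sumTo (suc k) T - T (suc k)
      ≡⟨ cong₂ _-_ (binomial (suc k) (+ a) (+ 1)) top ⟩
    (+ a + + 1) ^ suc k - (+ a) ^ suc k
      ≡⟨ cong (λ e → e ^ suc k - (+ a) ^ suc k)
              (trans (ℤP.+-comm (+ a) (+ 1)) (sym (ℤP.pos-+ 1 a))) ⟩
    (+ suc a) ^ suc k - (+ a) ^ suc k ∎
    where
    T : ℕ → ℤ
    T j = + (suc k C j) * (+ a) ^ j * (+ 1) ^ (suc k ∸ j)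
    top : T (suc k) ≡ (+ a) ^ suc k
    top = begin
      + (suc k C suc k) * (+ a) ^ suc k * (+ 1) ^ (suc k ∸ suc k)
        ≡⟨ cong₂ (λ c e → + c * (+ a) ^ suc k * (+ 1) ^ e) (nCn≡1 (suc k)) (ℕP.n∸n≡0 k) ⟩
      + 1 * (+ a) ^ suc k * + 1
        ≡⟨ ℤP.*-identityʳ _ ⟩
      + 1 * (+ a) ^ suc k
        ≡⟨ ℤP.*-identityˡ _ ⟩
      (+ a) ^ suc k ∎
    add-sub : ∀ s t → s ≡ (s + t) - t
    add-sub = solve-∀

-- In the recurrence for k = r all lower power sums vanish by induction, leaving
-- (r + 1) · powerSum m r ≡ p ^ (r + 1) ≡ 0, and r + 1 < p can be cancelled.
powerSum-vanishes : ∀ {m} → Prime (suc m) → ∀ r → r ℕ.< m → powerSum m r ≡ + 0 mod suc m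
powerSum-vanishes {m} p-prime = <-rec (λ r → r ℕ.< m → powerSum m r ≡ + 0 mod suc m) vanish
  where
  vanish : ∀ r → (∀ {j} → j ℕ.< r → j ℕ.< m → powerSum m j ≡ + 0 mod suc m) →
           r ℕ.< m → powerSum m r ≡ + 0 mod suc m
  vanish zero _ _ =
    ≡mod-trans (≡⇒≡mod (trans (sumTo-const m (+ 1)) (ℤP.*-identityʳ (+ suc m)))) n≡0-mod
  vanish (suc r) below r<m =
    *-cancelˡ-mod {x = + n} {z = + 0} p-prime (0<∣x∣<n⇒n∤x (+ n) refl (s≤s r<m)) leading≡0
    where
    open ≡mod-Reasoning (suc m)
    n : ℕ
    n = suc (suc r)
    lower≡0 : sumTo r (λ j → + (n C j) * powerSum m j) ≡ + 0 mod suc m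
    lower≡0 = sumTo-≡0-mod r (λ j j≤r →
      ≡mod-trans (*-cong-mod (≡mod-refl {x = + (n C j)})
                             (below (s≤s j≤r) (ℕP.<-trans (s≤s j≤r) r<m)))
                 (≡⇒≡mod (ℤP.*-zeroʳ (+ (n C j)))))
    leading≡0 : + n * powerSum m (suc r) ≡ + n * + 0 mod suc m
    leading≡0 = begin
      + n * powerSum m (suc r)
        ≡⟨ cong (λ c → + c * powerSum m (suc r)) (sym ([n+1]Cn≡n+1 (suc r))) ⟩
      + (n C suc r) * powerSum m (suc r)
        ≡⟨ sym (ℤP.+-identityˡ _) ⟩
      + 0 + + (n C suc r) * powerSum m (suc r)
        ≈⟨ +-cong-mod (≡mod-sym lower≡0) (≡mod-refl {x = + (n C suc r) * powerSum m (suc r)}) ⟩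
      sumTo (suc r) (λ j → + (n C j) * powerSum m j)
        ≡⟨ powerSum-recurrence m (suc r) ⟩
      (+ suc m) ^ n
        ≈⟨ n^suc≡0-mod (suc r) ⟩
      + 0
        ≡⟨ sym (ℤP.*-zeroʳ (+ n)) ⟩
      + n * + 0 ∎

powerSum-periodic : ∀ {m} → Prime (suc m) →
  ∀ r d → powerSum m (suc r ℕ.+ d ℕ.* m) ≡ powerSum m (suc r) mod suc m
powerSum-periodic {m} p-prime r d =
  sumTo-cong-mod m (λ a _ → ^-periodic (fermat p-prime (+ a)) r d)

powerSum-m-m : ∀ {m} → Prime (suc m) → powerSum m m ≡ - + 1 mod suc m
powerSum-m-m {m} p-prime = begin
  sumTo m (λ a → (+ a) ^ m)
    ≈⟨ sumTo-cong-mod m (λ a a≤m → fermat-indicator p-prime refl a≤m) ⟩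
  sumTo m (λ a → + 1 - (+ 0) ^ a)
    ≡⟨ sumTo-distrib-minus m _ _ ⟩
  sumTo m (λ _ → + 1) - sumTo m (λ a → (+ 0) ^ a)
    ≡⟨ cong₂ _-_ (trans (sumTo-const m (+ 1)) (ℤP.*-identityʳ (+ suc m)))
                 (trans (sumTo-cong m (λ a _ → sym (ℤP.*-identityˡ _))) (sumTo-*-0^ m (λ _ → + 1))) ⟩
  + suc m - + 1
    ≈⟨ minus-cong-mod n≡0-mod (≡mod-refl {x = + 1}) ⟩
  - + 1 ∎
  where open ≡mod-Reasoning (suc m)

powerSum-∤ : ∀ {m k} → Prime (suc m) → ¬ (m ℕD.∣ k) → powerSum m k ≡ + 0 mod suc m
powerSum-∤ {zero}      p-prime _   = contradiction p-prime ¬prime[1]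
powerSum-∤ {suc m} {k} p-prime m∤k with k % suc m in k%m≡r
... | zero  = contradiction (m%n≡0⇒n∣m k (suc m) k%m≡r) m∤k
... | suc r = begin
  powerSum (suc m) k
    ≡⟨ cong (powerSum (suc m)) (trans (m≡m%n+[m/n]*n k (suc m)) (cong (ℕ._+ d ℕ.* suc m) k%m≡r)) ⟩
  powerSum (suc m) (suc r ℕ.+ d ℕ.* suc m)
    ≈⟨ powerSum-periodic p-prime r d ⟩
  powerSum (suc m) (suc r)
    ≈⟨ powerSum-vanishes p-prime (suc r) (subst (ℕ._< suc m) k%m≡r (m%n<n k (suc m))) ⟩
  + 0 ∎
  where
  open ≡mod-Reasoning (suc (suc m))
  d : ℕ
  d = k / suc m

powerSum-∣ : ∀ {m k} → Prime (suc m) → k ≢ 0 → m ℕD.∣ k → powerSum m k ≡ - + 1 mod suc m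
powerSum-∣ {zero}  p-prime _   _                         = contradiction p-prime ¬prime[1]
powerSum-∣ {suc m} p-prime k≢0 (ℕD.divides zero refl)    = contradiction refl k≢0
powerSum-∣ {suc m} p-prime _   (ℕD.divides (suc d) refl) =
  ≡mod-trans (powerSum-periodic p-prime m d) (powerSum-m-m p-prime)

-- Poly-Bernoulli numbers of index p - 1 modulo p

powE-oneMinusExpNeg-mod : ∀ {m j} → Prime (suc m) → j ℕ.≤ m →
  powE oneMinusExpNeg j m ≡ (+ 0) ^ j - + 1 mod suc m
powE-oneMinusExpNeg-mod {m} {j} p-prime j≤m = begin
  powE oneMinusExpNeg j m
    ≡⟨ powE-oneMinusExpNeg j m ⟩
  sumTo j (λ i → c i * (- + i) ^ m)
    ≈⟨ sumTo-cong-mod j (λ i i≤j → *-cong-mod (≡mod-refl {x = c i})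
         (fermat-indicator p-prime (ℤP.∣-i∣≡∣i∣ (+ i)) (ℕP.≤-trans i≤j j≤m))) ⟩
  sumTo j (λ i → c i * (+ 1 - (+ 0) ^ i))
    ≡⟨ sumTo-cong j (λ i _ → split i) ⟩
  sumTo j (λ i → c i * (+ 1) ^ (j ∸ i) - c i * (+ 0) ^ i)
    ≡⟨ sumTo-distrib-minus j _ _ ⟩
  sumTo j (λ i → c i * (+ 1) ^ (j ∸ i)) - sumTo j (λ i → c i * (+ 0) ^ i)
    ≡⟨ cong₂ _-_ (binomial j (- + 1) (+ 1)) (sumTo-*-0^ j c) ⟩
  (+ 0) ^ j - + 1 ∎
  where
  open ≡mod-Reasoning (suc m)
  c : ℕ → ℤ
  c i = + (j C i) * (- + 1) ^ i
  split : ∀ i → c i * (+ 1 - (+ 0) ^ i) ≡ c i * (+ 1) ^ (j ∸ i) - c i * (+ 0) ^ i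
  split i = trans (expand (c i) ((+ 0) ^ i))
                  (cong (λ e → c i * e - c i * (+ 0) ^ i) (sym (ℤP.^-zeroˡ (j ∸ i))))
    where
    expand : ∀ c z → c * (+ 1 - z) ≡ c * + 1 - c * z
    expand = solve-∀

polyBernoulliNeg-mod : ∀ {m} → Prime (suc m) → ∀ k →
  polyBernoulliNeg k m ≡ + 1 - sumTo m (λ j → (+ suc j) ^ k) mod suc m
polyBernoulliNeg-mod {m} p-prime k = begin
  sumTo m (λ j → (+ suc j) ^ k * powE oneMinusExpNeg j m)
    ≈⟨ sumTo-cong-mod m (λ j j≤m → *-cong-mod (≡mod-refl {x = (+ suc j) ^ k})
                                               (powE-oneMinusExpNeg-mod p-prime j≤m)) ⟩
  sumTo m (λ j → (+ suc j) ^ k * ((+ 0) ^ j - + 1))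
    ≡⟨ sumTo-cong m (λ j _ → expand ((+ suc j) ^ k) ((+ 0) ^ j)) ⟩
  sumTo m (λ j → (+ suc j) ^ k * (+ 0) ^ j - (+ suc j) ^ k)
    ≡⟨ sumTo-distrib-minus m _ _ ⟩
  sumTo m (λ j → (+ suc j) ^ k * (+ 0) ^ j) - S
    ≡⟨ cong (_- S) (trans (sumTo-*-0^ m (λ j → (+ suc j) ^ k)) (ℤP.^-zeroˡ k)) ⟩
  + 1 - S ∎
  where
  open ≡mod-Reasoning (suc m)
  S : ℤ
  S = sumTo m (λ j → (+ suc j) ^ k)
  expand : ∀ a z → a * (z - + 1) ≡ a * z - a
  expand = solve-∀

polyBernoulliNeg-suc-mod : ∀ {m} → Prime (suc m) → ∀ k →
  polyBernoulliNeg (suc k) m ≡ + 1 - powerSum m (suc k) mod suc m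
polyBernoulliNeg-suc-mod {m} p-prime k = begin
  polyBernoulliNeg (suc k) m
    ≈⟨ polyBernoulliNeg-mod p-prime (suc k) ⟩
  + 1 - sumTo m (λ j → (+ suc j) ^ suc k)
    ≡⟨ cong (_-_ (+ 1)) (trans (sym (ℤP.+-identityˡ (sumTo m (λ j → (+ suc j) ^ suc k))))
                               (sym (sumTo-suc m (λ a → (+ a) ^ suc k)))) ⟩
  + 1 - (powerSum m (suc k) + (+ suc m) ^ suc k)
    ≈⟨ minus-cong-mod (≡mod-refl {x = + 1})
                      (+-cong-mod (≡mod-refl {x = powerSum m (suc k)}) (n^suc≡0-mod k)) ⟩
  + 1 - (powerSum m (suc k) + + 0)
    ≡⟨ cong (_-_ (+ 1)) (ℤP.+-identityʳ (powerSum m (suc k))) ⟩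
  + 1 - powerSum m (suc k) ∎
  where open ≡mod-Reasoning (suc m)

polyBernoulliNeg≡1 : ∀ {m k} → Prime (suc m) → k ≡ 0 ⊎ ¬ (m ℕD.∣ k) →
  polyBernoulliNeg k m ≡ + 1 mod suc m
polyBernoulliNeg≡1 {m} p-prime (inj₁ refl) = begin
  polyBernoulliNeg 0 m
    ≈⟨ polyBernoulliNeg-mod p-prime 0 ⟩
  + 1 - sumTo m (λ _ → + 1)
    ≡⟨ cong (_-_ (+ 1)) (trans (sumTo-const m (+ 1)) (ℤP.*-identityʳ (+ suc m))) ⟩
  + 1 - + suc m
    ≈⟨ minus-cong-mod (≡mod-refl {x = + 1}) n≡0-mod ⟩
  + 1 ∎
  where open ≡mod-Reasoning (suc m)
polyBernoulliNeg≡1 {m} {zero}  p-prime (inj₂ m∤k) = contradiction (m ∣0) m∤k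
polyBernoulliNeg≡1 {m} {suc k} p-prime (inj₂ m∤k) = begin
  polyBernoulliNeg (suc k) m  ≈⟨ polyBernoulliNeg-suc-mod p-prime k ⟩
  + 1 - powerSum m (suc k)    ≈⟨ minus-cong-mod (≡mod-refl {x = + 1}) (powerSum-∤ p-prime m∤k) ⟩
  + 1                         ∎
  where open ≡mod-Reasoning (suc m)

polyBernoulliNeg≡2 : ∀ {m k} → Prime (suc m) → k ≢ 0 × m ℕD.∣ k →
  polyBernoulliNeg k m ≡ + 2 mod suc m
polyBernoulliNeg≡2 {m} {zero}  p-prime (k≢0 , _)   = contradiction refl k≢0
polyBernoulliNeg≡2 {m} {suc k} p-prime (k≢0 , m∣k) = begin
  polyBernoulliNeg (suc k) m  ≈⟨ polyBernoulliNeg-suc-mod p-prime k ⟩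
  + 1 - powerSum m (suc k)    ≈⟨ minus-cong-mod (≡mod-refl {x = + 1}) (powerSum-∣ p-prime k≢0 m∣k) ⟩
  + 2                         ∎
  where open ≡mod-Reasoning (suc m)

-- The hypothesis p ≢ 2 is unused: Fermat's theorem is applied to - i directly,
-- so the parity of p - 1 never enters.
theorem3p1 : (p k : ℕ) → Prime p → p ≢ 2 →
    ((k ≡ 0 ⊎ ¬ ((p ∸ 1) ℕD.∣ k)) → (+ p) ℤD.∣ (polyBernoulliNeg k (p ∸ 1) - + 1))
    × ((k ≢ 0 × (p ∸ 1) ℕD.∣ k) → (+ p) ℤD.∣ (polyBernoulliNeg k (p ∸ 1) - + 2))
theorem3p1 zero    k p-prime _ = contradiction p-prime ¬prime[0]
theorem3p1 (suc m) k p-prime _ =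
  (λ hyp → ∣⇒∣ᵤ (∣-difference (polyBernoulliNeg≡1 p-prime hyp))) ,
  (λ hyp → ∣⇒∣ᵤ (∣-difference (polyBernoulliNeg≡2 p-prime hyp)))
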